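{- For every graph $G$, $\mathrm{ThrWidth}(G)=\mathrm{ThrWidth}(\overline{G})$, where $\overline{G}$ is the complement of $G$.
   Context: Graphs are finite, simple, undirected; digraphs may have loops but no multiple arcs. An $n$-partitioned graph is $(G,A_1,\dots,A_n)$ with $(A_1,\dots,A_n)$ a partition of $V(G)$ (parts may be empty). For a digraph $H$ on $\{1,\dots,n\}$, $(G,A_1,\dots,A_n)\circ_H(F,B_1,\dots,B_n)=(R,A_1\cup B_1,\dots,A_n\cup B_n)$ where $V(R)=V(G)\cup V(F)$ (disjoint union) and $E(R)=E(G)\cup E(F)\cup\{xy:x\in A_i,y\in B_j,(i,j)\in A(H)\}$; this operation is associative. $K^k_i$ denotes the $k$-partitioned graph with one vertex lying in the $i$-th part. A graph $G$ is $H$-threshold, for a digraph $H$ on $\{1,\dots,k\}$, if $G$ is the underlying graph of $K^k_{i_1}\circ_H\cdots\circ_H K^k_{i_m}$ for some $i_1,\dots,i_m$ (distinct vertices). The threshold-width $\mathrm{ThrWidth}(G)$ is the minimum number of vertices of a digraph $H$ such that $G$ is $H$-threshold (such $H$ always exists). -}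

module Defs where

open import Data.Nat using (ℕ; zero; suc; _+_; _≤_)
open import Data.Fin using (Fin; splitAt; _≟_)
open import Data.Sum using (inj₁; inj₂; [_,_])
open import Data.Bool using (Bool; true; false; not; if_then_else_)
open import Data.List using (List; []; _∷_; foldr)
open import Data.Product using (Σ; ∃; _×_; _,_)
open import Data.Empty using (⊥-elim)
open import Function using (_∘_)
open import Function.Bundles using (_↔_; Inverse)
open import Relation.Nullary using (yes; no)
open import Relation.Nullary.Decidable using (⌊_⌋)
open import Relation.Binary.PropositionalEquality using (_≡_; refl; cong)
  renaming (sym to ≡-sym)

record Graph : Set where
  field
    n      : ℕ
    adj    : Fin n → Fin n → Bool
    sym    : ∀ u v → adj u v ≡ adj v u
    irrefl : ∀ u → adj u u ≡ false
open Graph public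

complement : Graph → Graph
complement G = record { n = n G ; adj = cadj ; sym = csym ; irrefl = cirr }
  where
  cadj : Fin (n G) → Fin (n G) → Bool
  cadj u v = if ⌊ u ≟ v ⌋ then false else not (adj G u v)
  csym : ∀ u v → cadj u v ≡ cadj v u
  csym u v with u ≟ v | v ≟ u
  ... | yes _  | yes _  = refl
  ... | yes p  | no ¬q  = ⊥-elim (¬q (≡-sym p))
  ... | no ¬p  | yes q  = ⊥-elim (¬p (≡-sym q))
  ... | no _   | no _   = cong not (sym G u v)
  cirr : ∀ u → cadj u u ≡ false
  cirr u with u ≟ u
  ... | yes _  = refl
  ... | no ¬p  = ⊥-elim (¬p refl)

-- Digraphs on {1..k} (= Fin k), loops allowed, no multiple arcs:
-- arc relation (i , j) ∈ A(H) iff H i j ≡ true.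

Digraph : ℕ → Set
Digraph k = Fin k → Fin k → Bool

-- k-partitioned graphs (G, A_1, ..., A_k): a graph on Fin m together
-- with a map assigning each vertex the index of its part.
-- (Symmetry/irreflexivity are not needed to define the operation; the
-- underlying relation of every partitioned graph built below is a simple
-- graph, and `Underlying≅` only compares adjacency.)

record PGraph (k : ℕ) : Set where
  field
    size : ℕ
    padj : Fin size → Fin size → Bool
    part : Fin size → Fin k
open PGraph public

-- The operation ∘_H : vertices of the left operand come first
-- (Fin (m + m') split by splitAt); x ∈ A_i (left), y ∈ B_j (right)
-- are joined iff (i , j) is an arc of H.
compose : ∀ {k} → Digraph k → PGraph k → PGraph k → PGraph k
compose {k} H G F = record
  { size = size G + size F
  ; padj = λ x y → cadj (splitAt (size G) x) (splitAt (size G) y)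
  ; part = [ part G , part F ] ∘ splitAt (size G)
  }
  where
  open import Data.Sum using (_⊎_)
  cadj : Fin (size G) ⊎ Fin (size F) → Fin (size G) ⊎ Fin (size F) → Bool
  cadj (inj₁ a) (inj₁ b) = padj G a b
  cadj (inj₂ a) (inj₂ b) = padj F a b
  cadj (inj₁ a) (inj₂ b) = H (part G a) (part F b)
  cadj (inj₂ a) (inj₁ b) = H (part G b) (part F a)

K : ∀ {k} → Fin k → PGraph k
K i = record { size = 1 ; padj = λ _ _ → false ; part = λ _ → i }

Empty : ∀ {k} → PGraph k
Empty = record { size = 0 ; padj = λ () ; part = λ () }

-- K_{i_1} ∘_H ... ∘_H K_{i_m}  (associative; bracketed to the right).
composeAll : ∀ {k} → Digraph k → List (Fin k) → PGraph k
composeAll H = foldr (λ i P → compose H (K i) P) Empty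

Underlying≅ : ∀ {k} → Graph → PGraph k → Set
Underlying≅ G P =
  Σ (Fin (n G) ↔ Fin (size P)) λ φ →
    ∀ u v → adj G u v ≡ padj P (Inverse.to φ u) (Inverse.to φ v)

IsThreshold : ∀ {k} → Digraph k → Graph → Set
IsThreshold {k} H G = Σ (List (Fin k)) λ is → Underlying≅ G (composeAll H is)

ThrWidthIs : Graph → ℕ → Set
ThrWidthIs G k =
  Σ (Digraph k) (λ H → IsThreshold H G) ×
  (∀ k′ (H′ : Digraph k′) → IsThreshold H′ G → k ≤ k′)

module Submission where

-- Idea: complementing every arc of a digraph H (loops included) complements
-- the graph built by K_{i₁} ∘_H ⋯ ∘_H K_{iₘ}: two distinct vertices are joined
-- in the co-H composition exactly when they are not joined in the H one, because
-- the adjacency of an earlier vertex in part i with a later vertex in part j is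
-- decided by the single arc (i , j).  Hence every H-threshold representation of
-- G yields a co-H-threshold representation of the complement of G on the same
-- number k of digraph vertices, and conversely (using that complementation of
-- graphs is an involution).  A transformation of representations that preserves
-- k in both directions preserves the minimum k, which is the theorem.

open import Defs
open import Data.Nat using (ℕ)
open import Data.Product using (_×_; _,_)
open import Data.Fin using (Fin; zero; suc; _≟_)
open import Data.Fin.Properties using (suc-injective)
open import Data.Bool using (Bool; false; not; if_then_else_)
open import Data.Bool.Properties using (not-involutive)
open import Data.List using (_∷_)
open import Function.Bundles using (_↔_; Inverse; Injection; mk↔ₛ′; mk⇔)
open import Function.Properties.Inverse using (↔⇒↣)
open import Function.Construct.Composition using (_↔-∘_)
open import Relation.Nullary using (yes; no; does)
open import Relation.Nullary.Decidable using (⌊_⌋; ⌊⌋-map′; does-⇔; isYes≗does)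
open import Relation.Binary.PropositionalEquality
  using (_≡_; refl; cong; cong₂; module ≡-Reasoning)
  renaming (sym to ≡-sym)
open ≡-Reasoning

-- The complement of a Boolean relation on Fin n, taken off the diagonal;
-- `adj (complement G)` is by definition `coAdj (adj G)`.
coAdj : ∀ {n} → (Fin n → Fin n → Bool) → Fin n → Fin n → Bool
coAdj a u v = if ⌊ u ≟ v ⌋ then false else not (a u v)

coAdj-involutive : ∀ {n} (a : Fin n → Fin n → Bool) → (∀ u → a u u ≡ false) →
  ∀ u v → coAdj (coAdj a) u v ≡ a u v
coAdj-involutive a a-irrefl u v with u ≟ v
... | yes refl = ≡-sym (a-irrefl u)
... | no _     = not-involutive (a u v)

coAdj-relabel : ∀ {m n} (f : Fin m → Fin n) → (∀ {u v} → f u ≡ f v → u ≡ v) →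
  (a : Fin m → Fin m → Bool) (b : Fin n → Fin n → Bool) →
  (∀ u v → a u v ≡ b (f u) (f v)) →
  ∀ u v → coAdj a u v ≡ coAdj b (f u) (f v)
coAdj-relabel f f-injective a b a≡b u v =
  cong₂ (λ d c → if d then false else not c) same-equality (a≡b u v)
  where
  same-equality : ⌊ u ≟ v ⌋ ≡ ⌊ f u ≟ f v ⌋
  same-equality = begin
    ⌊ u ≟ v ⌋         ≡⟨ isYes≗does (u ≟ v) ⟩
    does (u ≟ v)      ≡⟨ does-⇔ (mk⇔ (cong f) f-injective) (u ≟ v) (f u ≟ f v) ⟩
    does (f u ≟ f v)  ≡⟨ ≡-sym (isYes≗does (f u ≟ f v)) ⟩
    ⌊ f u ≟ f v ⌋     ∎

coDigraph : ∀ {k} → Digraph k → Digraph k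
coDigraph H i j = not (H i j)

-- Compositions with the same part sequence have the same vertices, the
-- m-th vertex coming from the m-th one-vertex factor; `relabel` is this
-- identification, and it preserves parts.
module _ {k : ℕ} (H H′ : Digraph k) where
  relabel : ∀ is → Fin (size (composeAll H is)) → Fin (size (composeAll H′ is))
  relabel (i ∷ is) zero    = zero
  relabel (i ∷ is) (suc x) = suc (relabel is x)

  relabel-part : ∀ is x →
    part (composeAll H′ is) (relabel is x) ≡ part (composeAll H is) x
  relabel-part (i ∷ is) zero    = refl
  relabel-part (i ∷ is) (suc x) = relabel-part is x

relabel-inverse : ∀ {k} (H H′ : Digraph k) is x →
  relabel H′ H is (relabel H H′ is x) ≡ x
relabel-inverse H H′ (i ∷ is) zero    = refl
relabel-inverse H H′ (i ∷ is) (suc x) = cong suc (relabel-inverse H H′ is x)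

relabel↔ : ∀ {k} (H H′ : Digraph k) is →
  Fin (size (composeAll H is)) ↔ Fin (size (composeAll H′ is))
relabel↔ H H′ is = mk↔ₛ′ (relabel H H′ is) (relabel H′ H is)
  (relabel-inverse H′ H is) (relabel-inverse H H′ is)

-- A vertex meets a later one through a single arc of H, which coDigraph flips;
-- pairs of later vertices are handled by induction.
composeAll-coDigraph : ∀ {k} (H : Digraph k) is x y →
  padj (composeAll (coDigraph H) is) (relabel H (coDigraph H) is x)
                                     (relabel H (coDigraph H) is y)
  ≡ coAdj (padj (composeAll H is)) x y
composeAll-coDigraph H (i ∷ is) zero    zero    = refl
composeAll-coDigraph H (i ∷ is) zero    (suc y) =
  cong (λ j → not (H i j)) (relabel-part H (coDigraph H) is y)
composeAll-coDigraph H (i ∷ is) (suc x) zero    =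
  cong (λ j → not (H i j)) (relabel-part H (coDigraph H) is x)
composeAll-coDigraph H (i ∷ is) (suc x) (suc y) = begin
  padj (composeAll (coDigraph H) is) (relabel H (coDigraph H) is x)
                                     (relabel H (coDigraph H) is y)
    ≡⟨ composeAll-coDigraph H is x y ⟩
  coAdj (padj (composeAll H is)) x y
    ≡⟨ cong (λ d → if d then false else not (padj (composeAll H is) x y))
            (≡-sym (⌊⌋-map′ (cong suc) suc-injective (x ≟ y))) ⟩
  coAdj (padj (composeAll H (i ∷ is))) (suc x) (suc y)
    ∎

threshold-complement : ∀ {k} (H : Digraph k) G →
  IsThreshold H G → IsThreshold (coDigraph H) (complement G)
threshold-complement H G (is , φ , adj≡) =
  is , relabel↔ H (coDigraph H) is ↔-∘ φ , λ u v → begin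
    coAdj (adj G) u v
      ≡⟨ coAdj-relabel to (Injection.injective (↔⇒↣ φ)) (adj G) (padj P) adj≡ u v ⟩
    coAdj (padj P) (to u) (to v)
      ≡⟨ ≡-sym (composeAll-coDigraph H is (to u) (to v)) ⟩
    padj (composeAll (coDigraph H) is) (relabel H (coDigraph H) is (to u))
                                       (relabel H (coDigraph H) is (to v))
      ∎
  where
  P : PGraph _
  P = composeAll H is
  to : Fin (n G) → Fin (size P)
  to = Inverse.to φ

threshold-uncomplement : ∀ {k} (H : Digraph k) G →
  IsThreshold H (complement G) → IsThreshold (coDigraph H) G
threshold-uncomplement H G t
  with threshold-complement H (complement G) t
... | is , φ , adj≡ =
  is , φ , λ u v → begin
    adj G u v
      ≡⟨ ≡-sym (coAdj-involutive (adj G) (irrefl G) u v) ⟩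
    adj (complement (complement G)) u v
      ≡⟨ adj≡ u v ⟩
    padj (composeAll (coDigraph H) is) (Inverse.to φ u) (Inverse.to φ v)
      ∎

width-transfer : ∀ {G₁ G₂} (T : ∀ {k} → Digraph k → Digraph k) →
  (∀ {k} (H : Digraph k) → IsThreshold H G₁ → IsThreshold (T H) G₂) →
  (∀ {k} (H : Digraph k) → IsThreshold H G₂ → IsThreshold (T H) G₁) →
  ∀ k → ThrWidthIs G₁ k → ThrWidthIs G₂ k
width-transfer T forth back k ((H , t) , minimal) =
  (T H , forth H t) , λ k′ H′ t′ → minimal k′ (T H′) (back H′ t′)

proposition2 : ∀ (G : Graph) (k : ℕ) →
    (ThrWidthIs G k → ThrWidthIs (complement G) k) ×
    (ThrWidthIs (complement G) k → ThrWidthIs G k)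
proposition2 G k =
  width-transfer {G₁ = G} {G₂ = complement G} coDigraph
    (λ H → threshold-complement H G) (λ H → threshold-uncomplement H G) k ,
  width-transfer {G₁ = complement G} {G₂ = G} coDigraph
    (λ H → threshold-uncomplement H G) (λ H → threshold-complement H G) k
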